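{- Let $G$ be a digraph and let $\pi = (e_1, \ldots, e_k)$ be a switching walk or a switching circuit in $G$. Let $H \subseteq E(G)$ be (the edge set of) a Hamiltonian cycle in $G$. Then $H \cap \pi = \{e_{2i-1} \mid i = 1, \ldots, \lfloor \frac{k + 1}{2} \rfloor\}$ or $H \cap \pi = \{e_{2i} \mid i = 1, \ldots, \lfloor \frac{k}{2} \rfloor \}$.
   Context: For a vertex $v$ of a digraph $G$, the set $I^{\mathrm{in}}_v$ of all edges entering $v$ and the set $I^{\mathrm{out}}_v$ of all edges leaving $v$ are called the interfaces of $v$. Consider a sequence of distinct edges $\pi=(e_1,\ldots,e_k)$ such that, ignoring orientations, it forms a walk $v_1,\ldots,v_{k+1}$ in the underlying undirected graph, with $e_i$ an orientation of $v_iv_{i+1}$, and such that for every $i=2,\ldots,k$ either both $e_{i-1}$ and $e_i$ enter $v_i$ or both leave $v_i$. Let $I_1,\ldots,I_{k+1}$ be interfaces with $I_j$ an interface of $v_j$ and $e_j\in I_j\cap I_{j+1}$ for $j=1,\ldots,k$. If $|I_1|,|I_{k+1}|>2$ and $|I_j|=2$ for $j=2,\ldots,k$, then $\pi$ is a switching walk. If $|I_j|=2$ for all $j=1,\ldots,k$ and $v_1=v_{k+1}$, then $\pi$ is a switching circuit. $\pi$ is also regarded as the set $\{e_1,\ldots,e_k\}$. -}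

module Defs where

open import Data.Nat using (ℕ; zero; suc; _+_; _*_; _≤_; _<_; _/_)
open import Data.Nat.DivMod using (_mod_)
open import Data.Fin using (Fin; toℕ; inject₁; fromℕ; _≟_)
import Data.Fin as F
open import Data.List using (List; length; filter; allFin)
open import Data.Product using (Σ; ∃; _×_; _,_)
open import Data.Sum using (_⊎_)
open import Function.Definitions using (Injective; Surjective)
open import Relation.Binary.PropositionalEquality using (_≡_)

record Digraph : Set where
  field
    n   : ℕ
    m   : ℕ
    src : Fin m → Fin n
    tgt : Fin m → Fin n

open Digraph public

Vertex : Digraph → Set
Vertex G = Fin (n G)

Edge : Digraph → Set
Edge G = Fin (m G)

-- An interface of v is given by v together with a direction:
-- (v , inD) is I^in_v (edges entering v), (v , outD) is I^out_v (edges leaving v).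
data Dir : Set where
  inD outD : Dir

endpoint : (G : Digraph) → Dir → Edge G → Vertex G
endpoint G inD  e = tgt G e
endpoint G outD e = src G e

InInterface : (G : Digraph) → Vertex G → Dir → Edge G → Set
InInterface G v d e = endpoint G d e ≡ v

interfaceSize : (G : Digraph) → Vertex G → Dir → ℕ
interfaceSize G v d = length (filter (λ e → endpoint G d e ≟ v) (allFin (m G)))

-- Common data of a switching walk / circuit π = (e_1,…,e_k), 0-based:
-- edge e_{i+1} = π i (i : Fin k), vertex v_{j+1} = vert j (j : Fin (suc k)),
-- interface I_{j+1} = interface of vert j with direction dir j.
record WalkData (G : Digraph) (k : ℕ) (π : Fin k → Edge G) : Set where
  field
    vert : Fin (suc k) → Vertex G
    dir  : Fin (suc k) → Dir
    distinct : Injective _≡_ _≡_ π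
    orient : ∀ (i : Fin k) →
      (src G (π i) ≡ vert (inject₁ i) × tgt G (π i) ≡ vert (F.suc i)) ⊎
      (src G (π i) ≡ vert (F.suc i) × tgt G (π i) ≡ vert (inject₁ i))
    sameSide : ∀ (a b : Fin k) → toℕ b ≡ suc (toℕ a) →
      (tgt G (π a) ≡ vert (F.suc a) × tgt G (π b) ≡ vert (F.suc a)) ⊎
      (src G (π a) ≡ vert (F.suc a) × src G (π b) ≡ vert (F.suc a))
    inLeft  : ∀ (i : Fin k) → InInterface G (vert (inject₁ i)) (dir (inject₁ i)) (π i)
    inRight : ∀ (i : Fin k) → InInterface G (vert (F.suc i)) (dir (F.suc i)) (π i)

  size : Fin (suc k) → ℕ
  size j = interfaceSize G (vert j) (dir j)

IsSwitchingWalk : (G : Digraph) (k : ℕ) (π : Fin k → Edge G) → Set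
IsSwitchingWalk G k π = Σ (WalkData G k π) λ W →
  let open WalkData W in
    (2 < size F.zero) × (2 < size (fromℕ k)) ×
    (∀ (j : Fin (suc k)) → 0 < toℕ j → toℕ j < k → size j ≡ 2)

IsSwitchingCircuit : (G : Digraph) (k : ℕ) (π : Fin k → Edge G) → Set
IsSwitchingCircuit G k π = Σ (WalkData G k π) λ W →
  let open WalkData W in
    (∀ (i : Fin k) → size (inject₁ i) ≡ 2) × (vert F.zero ≡ vert (fromℕ k))

next : ∀ {n} → Fin n → Fin n
next {suc n} i = suc (toℕ i) mod suc n

record HamCycle (G : Digraph) : Set where
  field
    σ     : Fin (n G) → Vertex G
    σ-inj : Injective _≡_ _≡_ σ
    σ-sur : Surjective _≡_ _≡_ σ
    h     : Fin (n G) → Edge G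
    h-src : ∀ i → src G (h i) ≡ σ i
    h-tgt : ∀ i → tgt G (h i) ≡ σ (next i)

InH : {G : Digraph} → HamCycle G → Edge G → Set
InH C e = ∃ λ i → HamCycle.h C i ≡ e

InPi : {G : Digraph} {k : ℕ} → (Fin k → Edge G) → Edge G → Set
InPi π e = ∃ λ i → π i ≡ e

-- { e_{2i-1} | i = 1..⌊(k+1)/2⌋ }   (e_{2i-1} = π at 0-based index 2i-2)
InOdd : {G : Digraph} {k : ℕ} → (Fin k → Edge G) → Edge G → Set
InOdd {k = k} π e = ∃ λ (i : ℕ) → (1 ≤ i) × (i ≤ (k + 1) / 2) ×
  ∃ λ (j : Fin k) → (toℕ j + 2 ≡ 2 * i) × (π j ≡ e)

-- { e_{2i} | i = 1..⌊k/2⌋ }   (e_{2i} = π at 0-based index 2i-1)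
InEven : {G : Digraph} {k : ℕ} → (Fin k → Edge G) → Edge G → Set
InEven {k = k} π e = ∃ λ (i : ℕ) → (1 ≤ i) × (i ≤ k / 2) ×
  ∃ λ (j : Fin k) → (toℕ j + 1 ≡ 2 * i) × (π j ≡ e)

-- Every vertex is left by exactly one edge of a Hamiltonian cycle H and entered by
-- exactly one, so H meets every interface in exactly one edge. Consecutive edges
-- e_i, e_{i+1} of a switching walk or circuit are the two edges of an interface of
-- size 2, hence exactly one of them lies in H. Membership in H therefore alternates
-- along π, and is determined by whether e_1 ∈ H.
module Submission where

open import Defs
open import Data.Nat using (ℕ; zero; suc; _+_; _*_; _≤_; _<_; _%_; s≤s; z≤n; _/_)
import Data.Nat as ℕ
open import Data.Nat.Properties using (+-comm; *-comm; ≤-refl; <⇒≤; 1+n≢n; module ≤-Reasoning)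
open import Data.Nat.DivMod using (m<n⇒m%n≡m; n%n≡0; m*n/n≡m; /-mono-≤)
open import Data.Nat.Divisibility using (_∣_; divides; _∣0; ∣-refl; ∣1⇒≡1; ∣m∣n⇒∣m+n; ∣m+n∣m⇒∣n)
open import Data.Fin using (Fin; toℕ; inject₁; fromℕ; fromℕ<)
import Data.Fin as F
open import Data.Fin.Properties using (toℕ-injective; toℕ-fromℕ<; toℕ-inject₁; toℕ-fromℕ; toℕ<n; any?)
open import Data.Fin.Relation.Unary.Top using (view; ‵fromℕ; ‵inject₁)
open import Data.List using (List; []; _∷_; length; filter; allFin)
open import Data.List.Membership.Propositional using (_∈_)
open import Data.List.Membership.Propositional.Properties using (∈-filter⁺; ∈-allFin)
open import Data.List.Relation.Unary.Any using (here; there)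
open import Data.Product using (∃; _×_; _,_; proj₂)
open import Data.Sum using (_⊎_; inj₁; inj₂; [_,_]′)
open import Data.Empty using (⊥-elim)
open import Function using (id; _∘_)
open import Function.Bundles using (_⇔_; mk⇔; Equivalence)
open import Function.Construct.Composition using (_⇔-∘_)
open import Function.Definitions using (Injective; StrictlySurjective)
open import Relation.Nullary using (¬_; yes; no)
open import Relation.Nullary.Decidable using (_×-dec_)
open import Relation.Unary using (Decidable)
open import Relation.Binary.PropositionalEquality

module _ {N : ℕ} where

  toℕ-next : (i : Fin (suc N)) → toℕ (next i) ≡ suc (toℕ i) % suc N
  toℕ-next i = toℕ-fromℕ< _

  next-fromℕ : next (fromℕ N) ≡ F.zero
  next-fromℕ = toℕ-injective (begin
    toℕ (next (fromℕ N))        ≡⟨ toℕ-next (fromℕ N) ⟩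
    suc (toℕ (fromℕ N)) % suc N ≡⟨ cong (λ t → suc t % suc N) (toℕ-fromℕ N) ⟩
    suc N % suc N               ≡⟨ n%n≡0 (suc N) ⟩
    0                           ∎)
    where open ≡-Reasoning

  next-inject₁ : (t : Fin N) → next (inject₁ t) ≡ F.suc t
  next-inject₁ t = toℕ-injective (begin
    toℕ (next (inject₁ t))        ≡⟨ toℕ-next (inject₁ t) ⟩
    suc (toℕ (inject₁ t)) % suc N ≡⟨ cong (λ s → suc s % suc N) (toℕ-inject₁ t) ⟩
    suc (toℕ t) % suc N           ≡⟨ m<n⇒m%n≡m (s≤s (toℕ<n t)) ⟩
    suc (toℕ t)                   ∎)
    where open ≡-Reasoning

  prev : Fin (suc N) → Fin (suc N)
  prev F.zero    = fromℕ N
  prev (F.suc t) = inject₁ t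

  next-prev : (t : Fin (suc N)) → next (prev t) ≡ t
  next-prev F.zero    = next-fromℕ
  next-prev (F.suc t) = next-inject₁ t

  prev-next : (i : Fin (suc N)) → prev (next i) ≡ i
  prev-next i with view i
  ... | ‵fromℕ     = cong prev next-fromℕ
  ... | ‵inject₁ t = cong prev (next-inject₁ t)

next-injective : ∀ {N} → Injective _≡_ _≡_ (next {N})
next-injective {suc N} {i} {j} eq = begin
  i              ≡⟨ prev-next i ⟨
  prev (next i)  ≡⟨ cong prev eq ⟩
  prev (next j)  ≡⟨ prev-next j ⟩
  j              ∎
  where open ≡-Reasoning

advance : ∀ {N} → Dir → Fin N → Fin N
advance inD  = next
advance outD = id

advance-injective : ∀ {N} d → Injective _≡_ _≡_ (advance {N} d)
advance-injective inD  = next-injective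
advance-injective outD = id

advance-strictlySurjective : ∀ {N} d → StrictlySurjective _≡_ (advance {N} d)
advance-strictlySurjective {suc N} inD t = prev t , next-prev t
advance-strictlySurjective outD t = t , refl

ExactlyOne : Set → Set → Set
ExactlyOne A B = (A ⊎ B) × ¬ (A × B)

exactlyOne-⇔ : ∀ {A B P Q : Set} → ExactlyOne A B → ExactlyOne P Q → A ⇔ P → B ⇔ Q
exactlyOne-⇔ (a⊎b , ¬a×b) (p⊎q , ¬p×q) a⇔p = mk⇔
  (λ b → [ (λ p → ⊥-elim (¬a×b (Equivalence.from a⇔p p , b))) , id ]′ p⊎q)
  (λ q → [ (λ a → ⊥-elim (¬p×q (Equivalence.to a⇔p a , q))) , id ]′ a⊎b)

∈-length≡2 : ∀ {A : Set} (xs : List A) {x y z : A} → length xs ≡ 2 →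
  x ∈ xs → y ∈ xs → ¬ x ≡ y → z ∈ xs → z ≡ x ⊎ z ≡ y
∈-length≡2 (a ∷ b ∷ []) _ (here refl)         (here refl)         x≢y _ = ⊥-elim (x≢y refl)
∈-length≡2 (a ∷ b ∷ []) _ (there (here refl)) (there (here refl)) x≢y _ = ⊥-elim (x≢y refl)
∈-length≡2 (a ∷ b ∷ []) _ (here refl)         (there (here refl)) _ (here refl)         = inj₁ refl
∈-length≡2 (a ∷ b ∷ []) _ (here refl)         (there (here refl)) _ (there (here refl)) = inj₂ refl
∈-length≡2 (a ∷ b ∷ []) _ (there (here refl)) (here refl)         _ (here refl)         = inj₂ refl
∈-length≡2 (a ∷ b ∷ []) _ (there (here refl)) (here refl)         _ (there (here refl)) = inj₁ refl

module HamiltonianCycle {G : Digraph} (C : HamCycle G) where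
  open HamCycle C

  endpoint-h : ∀ d i → endpoint G d (h i) ≡ σ (advance d i)
  endpoint-h inD  = h-tgt
  endpoint-h outD = h-src

  InH? : Decidable (InH C)
  InH? e = any? (λ i → h i F.≟ e)

  InH-at-interface : ∀ v d → ∃ λ e → InH C e × endpoint G d e ≡ v
  InH-at-interface v d =
    let (i₀ , σi₀≡v) = σ-sur v
        (i , advance-i≡i₀) = advance-strictlySurjective d i₀
    in h i , (i , refl) , trans (endpoint-h d i) (trans (cong σ advance-i≡i₀) (σi₀≡v refl))

  InH-at-interface-unique : ∀ {v} d {x y} → InH C x → InH C y →
    endpoint G d x ≡ v → endpoint G d y ≡ v → x ≡ y
  InH-at-interface-unique d (i , refl) (j , refl) hi≡v hj≡v =
    cong h (advance-injective d (σ-inj (begin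
      σ (advance d i)      ≡⟨ endpoint-h d i ⟨
      endpoint G d (h i)   ≡⟨ trans hi≡v (sym hj≡v) ⟩
      endpoint G d (h j)   ≡⟨ endpoint-h d j ⟩
      σ (advance d j)      ∎)))
    where open ≡-Reasoning

  InH-exactlyOne : ∀ v d {x y} → interfaceSize G v d ≡ 2 → ¬ x ≡ y →
    endpoint G d x ≡ v → endpoint G d y ≡ v → ExactlyOne (InH C x) (InH C y)
  InH-exactlyOne v d {x} {y} size≡2 x≢y x∈I y∈I =
    InH-x⊎y , λ (x∈H , y∈H) → x≢y (InH-at-interface-unique d x∈H y∈H x∈I y∈I)
    where
    member : ∀ {z} → endpoint G d z ≡ v → z ∈ filter (λ e → endpoint G d e F.≟ v) (allFin (m G))
    member = ∈-filter⁺ (λ e → endpoint G d e F.≟ v) (∈-allFin _)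

    InH-x⊎y : InH C x ⊎ InH C y
    InH-x⊎y with InH-at-interface v d
    ... | e , e∈H , e∈I with ∈-length≡2 _ size≡2 (member x∈I) (member y∈I) x≢y (member e∈I)
    ... | inj₁ refl = inj₁ e∈H
    ... | inj₂ refl = inj₂ e∈H

Alternating : ∀ {k} → (Fin k → Set) → Set
Alternating {k} P = ∀ (a b : Fin k) → toℕ b ≡ suc (toℕ a) → ExactlyOne (P a) (P b)

alternating-⇔ : ∀ {k} {P Q : Fin k → Set} → Alternating P → Alternating Q →
  (∀ z → toℕ z ≡ 0 → P z ⇔ Q z) → ∀ j → P j ⇔ Q j
alternating-⇔ {k} {P} {Q} altP altQ base j = go (toℕ j) j refl
  where
  go : ∀ t (j : Fin k) → toℕ j ≡ t → P j ⇔ Q j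
  go zero    j j≡0 = base j j≡0
  go (suc t) j j≡t+1 = exactlyOne-⇔ (altP i j b≡a+1) (altQ i j b≡a+1) (go t i (toℕ-fromℕ< t<k))
    where
    t<k : t < k
    t<k = subst (_≤ k) j≡t+1 (<⇒≤ (toℕ<n j))
    i : Fin k
    i = fromℕ< t<k
    b≡a+1 : toℕ j ≡ suc (toℕ i)
    b≡a+1 = trans j≡t+1 (cong suc (sym (toℕ-fromℕ< t<k)))

alternating-toℕ : ∀ {k} {R : ℕ → Set} → (∀ t → ExactlyOne (R t) (R (suc t))) →
  Alternating {k} (R ∘ toℕ)
alternating-toℕ {R = R} alt a b b≡a+1 = subst (ExactlyOne (R (toℕ a)) ∘ R) (sym b≡a+1) (alt (toℕ a))

parity-exactlyOne : ∀ t → ExactlyOne (2 ∣ t) (2 ∣ suc t)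
parity-exactlyOne t = even⊎odd t , λ (2∣t , 2∣t+1) →
  2≢1 (∣1⇒≡1 (∣m+n∣m⇒∣n (subst (2 ∣_) (+-comm 1 t) 2∣t+1) 2∣t))
  where
  even⊎odd : ∀ t → 2 ∣ t ⊎ 2 ∣ suc t
  even⊎odd zero    = inj₁ (2 ∣0)
  even⊎odd (suc t) = [ inj₂ ∘ ∣m∣n⇒∣m+n ∣-refl , inj₁ ]′ (even⊎odd t)
  2≢1 : ¬ 2 ≡ 1
  2≢1 ()

-- The edges e_{2i-1} are those at even 0-based index, the edges e_{2i} those at odd index.

half-≤ : ∀ i n → 2 * i ≤ n → i ≤ n / 2
half-≤ i n 2i≤n = subst (_≤ n / 2) (m*n/n≡m i 2) (/-mono-≤ {o = 2} {p = 2} (subst (_≤ n) (*-comm 2 i) 2i≤n) ≤-refl)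

module _ {G : Digraph} {k : ℕ} (π : Fin k → Edge G) where

  evenIndexed⇔InOdd : ∀ e → (∃ λ j → 2 ∣ toℕ j × π j ≡ e) ⇔ InOdd {G} π e
  evenIndexed⇔InOdd e = mk⇔
    (λ (j , divides q j≡q*2 , πj≡e) →
       let j+2≡2[1+q] = trans (cong (_+ 2) j≡q*2) (trans (+-comm (q * 2) 2) (*-comm (suc q) 2))
       in suc q , s≤s z≤n , half-≤ (suc q) (k + 1) (bound j {suc q} j+2≡2[1+q]) , j , j+2≡2[1+q] , πj≡e)
    (λ (i , _ , _ , j , j+2≡2i , πj≡e) →
       let 2∣2+j = divides i (trans (+-comm 2 (toℕ j)) (trans j+2≡2i (*-comm 2 i)))
       in j , ∣m+n∣m⇒∣n 2∣2+j ∣-refl , πj≡e)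
    where
    bound : ∀ (j : Fin k) {i} → toℕ j + 2 ≡ 2 * i → 2 * i ≤ k + 1
    bound j {i} j+2≡2i = begin
      2 * i             ≡⟨ j+2≡2i ⟨
      toℕ j + 2         ≡⟨ +-comm (toℕ j) 2 ⟩
      suc (suc (toℕ j)) ≤⟨ s≤s (toℕ<n j) ⟩
      suc k             ≡⟨ +-comm 1 k ⟩
      k + 1             ∎
      where open ≤-Reasoning

  oddIndexed⇔InEven : ∀ e → (∃ λ j → 2 ∣ suc (toℕ j) × π j ≡ e) ⇔ InEven {G} π e
  oddIndexed⇔InEven e = mk⇔
    (λ { (j , divides zero () , _)
      ; (j , divides (suc q) 1+j≡[1+q]*2 , πj≡e) →
          let j+1≡2[1+q] = trans (+-comm (toℕ j) 1) (trans 1+j≡[1+q]*2 (*-comm (suc q) 2))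
              2[1+q]≤k = subst (_≤ k) (trans (+-comm 1 (toℕ j)) j+1≡2[1+q]) (toℕ<n j)
          in suc q , s≤s z≤n , half-≤ (suc q) k 2[1+q]≤k , j , j+1≡2[1+q] , πj≡e })
    (λ (i , _ , _ , j , j+1≡2i , πj≡e) →
       j , divides i (trans (+-comm 1 (toℕ j)) (trans j+1≡2i (*-comm 2 i))) , πj≡e)

  ∩-image⇔ : (S : Edge G → Set) (R : Fin k → Set) → (∀ j → S (π j) ⇔ R j) →
    ∀ e → (S e × InPi {G} π e) ⇔ (∃ λ j → R j × π j ≡ e)
  ∩-image⇔ S R Sπ⇔R e = mk⇔
    (λ (Se , j , πj≡e) → j , Equivalence.to (Sπ⇔R j) (subst S (sym πj≡e) Se) , πj≡e)
    (λ (j , Rj , πj≡e) → subst S πj≡e (Equivalence.from (Sπ⇔R j) Rj) , j , πj≡e)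

  alternating⇒odd⊎even : (S : Edge G → Set) → Decidable S → Alternating (S ∘ π) →
    (∀ e → (S e × InPi {G} π e) ⇔ InOdd {G} π e) ⊎ (∀ e → (S e × InPi {G} π e) ⇔ InEven {G} π e)
  alternating⇒odd⊎even S S? alt with any? (λ z → (toℕ z ℕ.≟ 0) ×-dec S? (π z))
  ... | yes (z , z≡0 , Sπz) = inj₁ λ e →
    evenIndexed⇔InOdd e ⇔-∘ ∩-image⇔ S _ (alternating-⇔ alt (alternating-toℕ parity-exactlyOne) base) e
    where
    base : ∀ z′ → toℕ z′ ≡ 0 → S (π z′) ⇔ 2 ∣ toℕ z′
    base z′ z′≡0 = mk⇔
      (λ _ → subst (2 ∣_) (sym z′≡0) (2 ∣0))
      (λ _ → subst (S ∘ π) (toℕ-injective (trans z≡0 (sym z′≡0))) Sπz)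
  ... | no ¬Sπ0 = inj₂ λ e →
    oddIndexed⇔InEven e ⇔-∘ ∩-image⇔ S _ (alternating-⇔ alt (alternating-toℕ (parity-exactlyOne ∘ suc)) base) e
    where
    base : ∀ z → toℕ z ≡ 0 → S (π z) ⇔ 2 ∣ suc (toℕ z)
    base z z≡0 = mk⇔
      (λ Sπz → ⊥-elim (¬Sπ0 (z , z≡0 , Sπz)))
      (λ 2∣1+z → ⊥-elim (proj₂ (parity-exactlyOne 0) (2 ∣0 , subst (λ t → 2 ∣ suc t) z≡0 2∣1+z)))

module _ {G : Digraph} {k : ℕ} {π : Fin k → Edge G} where

  InnerInterfacesOfSize2 : WalkData G k π → Set
  InnerInterfacesOfSize2 W = ∀ (a b : Fin k) → toℕ b ≡ suc (toℕ a) → WalkData.size W (F.suc a) ≡ 2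

  switching⇒innerInterfacesOfSize2 : IsSwitchingWalk G k π ⊎ IsSwitchingCircuit G k π →
    ∃ λ W → InnerInterfacesOfSize2 W
  switching⇒innerInterfacesOfSize2 (inj₁ (W , _ , _ , inner)) =
    W , λ a b b≡a+1 → inner (F.suc a) (s≤s z≤n) (subst (_< k) b≡a+1 (toℕ<n b))
  switching⇒innerInterfacesOfSize2 (inj₂ (W , all , _)) =
    W , λ a b b≡a+1 → subst (λ j → WalkData.size W j ≡ 2) (toℕ-injective (trans (toℕ-inject₁ b) b≡a+1)) (all b)

  InH-alternating : (C : HamCycle G) (W : WalkData G k π) → InnerInterfacesOfSize2 W →
    Alternating (InH C ∘ π)
  InH-alternating C W inner a b b≡a+1 = HamiltonianCycle.InH-exactlyOne C (vert (F.suc a)) (dir (F.suc a)) (inner a b b≡a+1)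
      πa≢πb (inRight a) πb∈I
    where
    open WalkData W
    πa≢πb : ¬ π a ≡ π b
    πa≢πb πa≡πb = 1+n≢n (sym (trans (cong toℕ (distinct πa≡πb)) b≡a+1))
    πb∈I : endpoint G (dir (F.suc a)) (π b) ≡ vert (F.suc a)
    πb∈I = subst (λ j → endpoint G (dir j) (π b) ≡ vert j)
      (toℕ-injective (trans (toℕ-inject₁ b) b≡a+1)) (inLeft b)

lemma5 : (G : Digraph) (k : ℕ) (π : Fin k → Edge G) →
    (IsSwitchingWalk G k π ⊎ IsSwitchingCircuit G k π) →
    (C : HamCycle G) →
    (∀ e → (InH C e × InPi {G} π e) ⇔ InOdd {G} π e) ⊎ (∀ e → (InH C e × InPi {G} π e) ⇔ InEven {G} π e)
lemma5 G k π switching C =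
  let (W , inner) = switching⇒innerInterfacesOfSize2 switching
  in alternating⇒odd⊎even {G} π (InH C) InH? (InH-alternating C W inner)
  where open HamiltonianCycle C using (InH?)
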